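{- Let $q$ be a positive integer and $A_q=(c_q(m-n))_{m,n=1}^q$. For $1\le j\le q$ let $\omega_j=\exp(2\pi i j/q)$, $q'=q/\gcd(j,q)$, and let $v_j$ be the (column) vector of length $q$ obtained by concatenating $q/q'$ copies of the block $(1,\omega_j,\omega_j^2,\dots,\omega_j^{q'-1})$ (when $\gcd(j,q)=1$ this is $(1,\omega_j,\dots,\omega_j^{q-1})$). Then $A_qv_j=\lambda_jv_j$, where $\lambda_j=q$ if $\gcd(j,q)=1$ and $\lambda_j=0$ if $\gcd(j,q)>1$; these $\lambda_j$ ($1\le j\le q$) are the eigenvalues of $A_q$ with eigenvectors $v_j$.
   Context: For a positive integer $q$ and any integer $n$, the Ramanujan sum is $c_q(n)=\sum_{1\le k\le q,\ \gcd(k,q)=1}\exp(2\pi i kn/q)$. -}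

module Defs where

open import Level using (_⊔_)
open import Data.Bool using (Bool; if_then_else_)
open import Data.Nat using (ℕ; zero; suc; _∸_; _≤_; _<_)
import Data.Nat as ℕ
open import Data.Nat.GCD using (gcd)
open import Data.Integer as ℤ using (ℤ; +_)
open import Data.Sum using (_⊎_)
open import Relation.Nullary using (¬_; does)
open import Algebra.Bundles using (CommutativeRing)

-- Total versions of ℕ division/remainder (only ever applied to nonzero
-- divisors in the statement; the zero case is a harmless default).
_divN_ : ℕ → ℕ → ℕ
n divN zero    = zero
n divN (suc k) = n ℕ./ suc k

_modN_ : ℕ → ℕ → ℕ
n modN zero    = n
n modN (suc k) = n ℕ.% suc k

_modZ_ : ℤ → ℕ → ℕ
n modZ zero    = ℤ.∣ n ∣
n modZ (suc k) = n ℤ.% (+ suc k)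

coprime? : ℕ → ℕ → Bool
coprime? k q = does (gcd k q ℕ.≟ 1)

module Ramanujan {c ℓ} (R : CommutativeRing c ℓ) where
  open CommutativeRing R

  pow : Carrier → ℕ → Carrier
  pow x zero    = 1#
  pow x (suc n) = x * pow x n

  fromℕ : ℕ → Carrier
  fromℕ zero    = 0#
  fromℕ (suc n) = 1# + fromℕ n

  Σ₁ : ℕ → (ℕ → Carrier) → Carrier
  Σ₁ zero    f = 0#
  Σ₁ (suc n) f = Σ₁ n f + f (suc n)

  IsIntegralDomain : Set (c ⊔ ℓ)
  IsIntegralDomain = (¬ (1# ≈ 0#)) × (∀ x y → x * y ≈ 0# → x ≈ 0# ⊎ y ≈ 0#)
    where open import Data.Product using (_×_)

  IsPrimitiveRoot : Carrier → ℕ → Set ℓ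
  IsPrimitiveRoot ζ q = (pow ζ q ≈ 1#) × (∀ d → 1 ≤ d → d < q → ¬ (pow ζ d ≈ 1#))
    where open import Data.Product using (_×_)

  module WithRoot (ζ : Carrier) (q : ℕ) where
    -- ζ raised to an integer power n; since ζ^q = 1 this is ζ^(n mod q)
    zpow : ℤ → Carrier
    zpow n = pow ζ (n modZ q)

    cq : ℤ → Carrier
    cq n = Σ₁ q (λ k → if coprime? k q then zpow (+ k ℤ.* n) else 0#)

    -- the matrix A_q = (c_q(m - n))_{m,n=1..q} (indices 1-based)
    A : ℕ → ℕ → Carrier
    A m n = cq (+ m ℤ.- + n)

    ω : ℕ → Carrier
    ω j = pow ζ j

    q′ : ℕ → ℕ
    q′ j = q divN gcd j q

    -- v_j : concatenation of q/q' copies of (1, ω_j, …, ω_j^{q'-1});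
    -- its n-th entry (n = 1..q) is ω_j^((n-1) mod q')
    v : ℕ → ℕ → Carrier
    v j n = pow (ω j) ((n ∸ 1) modN q′ j)

    λ′ : ℕ → Carrier
    λ′ j = if coprime? j q then fromℕ q else 0#

    Av : ℕ → ℕ → Carrier
    Av j m = Σ₁ q (λ n → A m n * v j n)

{-# OPTIONS --safe #-}
-- Since ω_j^{q'} = 1, the entries of v_j are v_j(n) = ω_j^{n-1}. Writing A(m,n) = Σ_{k coprime to q} ζ^{k(m-n)}
-- and exchanging the sums, (A v_j)(m) = Σ_{k coprime to q} ζ^{km-j} Σ_{n=1}^{q} (ζ^{j-k})^n. The inner geometric
-- sum is q for k = j and vanishes for k ≠ j, because ζ^{j-k} ≠ 1 is a q-th root of unity in a ring without zero
-- divisors. Independence of the v_j is the Vandermonde argument for the distinct nodes ω_j = ζ^j: multiplying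
-- each coefficient a_i by ω_i - ω_N turns vanishing power sums over N nodes into ones over the first N - 1 nodes.
module Submission where

open import Defs
open import Level using (Level)
open import Data.Nat using (ℕ; _≤_; NonZero)
open import Data.Product using (_×_)
open import Algebra.Bundles using (CommutativeRing)

open import Data.Nat as ℕ using (zero; suc; s≤s; z≤n; _<_; _∸_)
import Data.Nat.Properties as ℕ
import Data.Nat.DivMod as ℕ
open import Data.Nat.Divisibility using (_∣_; divides)
open import Data.Nat.GCD using (gcd; gcd[m,n]∣m; gcd[m,n]∣n)
open import Data.Integer as ℤ using (+_; -[1+_])
import Data.Integer.Properties as ℤ
import Data.Integer.DivMod as ℤ
open import Data.Integer.Tactic.RingSolver using (solve-∀)
open import Data.Bool using (true; false; if_then_else_)
open import Data.Product using (Σ-syntax; _,_; proj₁; proj₂)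
open import Data.Sum using (_⊎_; inj₁; inj₂)
open import Relation.Nullary using (¬_; contradiction)
open import Relation.Binary.PropositionalEquality as ≡ using (_≡_; _≢_)
open import Relation.Binary.Definitions using (tri<; tri≈; tri>)

module _ where
  open import Data.Integer using (_+_; _*_; _-_; -_)

  pos-+-* : ∀ y q s → + (y ℕ.+ q ℕ.* s) ≡ + y + + s * + q
  pos-+-* y q s = ≡.cong (λ z → + y + z) (≡.trans (ℤ.pos-* q s) (ℤ.*-comm (+ q) (+ s)))

  congruent⇒apart-by-multiple : ∀ x y t q → + x ≡ + y + t * + q →
    (Σ[ s ∈ ℕ ] x ≡ y ℕ.+ q ℕ.* s) ⊎ (Σ[ s ∈ ℕ ] y ≡ x ℕ.+ q ℕ.* s)
  congruent⇒apart-by-multiple x y (+ s) q x≡y+sq = inj₁ (s , ℤ.+-injective (≡.trans x≡y+sq (≡.sym (pos-+-* y q s))))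
  congruent⇒apart-by-multiple x y -[1+ s ] q x≡y-sq = inj₂ (suc s , ℤ.+-injective (begin
    + y                        ≡⟨ flip (+ y) (+ suc s) (+ q) ⟩
    (+ y + -[1+ s ] * + q) + + suc s * + q ≡⟨ ≡.cong (_+ + suc s * + q) (≡.sym x≡y-sq) ⟩
    + x + + suc s * + q        ≡⟨ ≡.sym (pos-+-* x q (suc s)) ⟩
    + (x ℕ.+ q ℕ.* suc s)      ∎))
    where
      open ≡.≡-Reasoning
      flip : ∀ y u Q → y ≡ (y + (- u) * Q) + u * Q
      flip = solve-∀

  residues-align : ∀ a A B s t Q → a ≡ A + s * Q → a ≡ B + t * Q → A ≡ B + (t - s) * Q
  residues-align a A B s t Q a≡A+sQ a≡B+tQ = begin
    A                  ≡⟨ shift A s Q ⟩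
    (A + s * Q) - s * Q ≡⟨ ≡.cong (_- s * Q) (≡.trans (≡.sym a≡A+sQ) a≡B+tQ) ⟩
    (B + t * Q) - s * Q ≡⟨ regroup B t s Q ⟩
    B + (t - s) * Q    ∎
    where
      open ≡.≡-Reasoning
      shift : ∀ A s Q → A ≡ (A + s * Q) - s * Q
      shift = solve-∀
      regroup : ∀ B t s Q → (B + t * Q) - s * Q ≡ B + (t - s) * Q
      regroup = solve-∀

  [j-k]+k≡j : ∀ j k → (j - k) + k ≡ j
  [j-k]+k≡j = solve-∀

  j*[1+m]-j≡m*j : ∀ j m → j * (+ 1 + m) - j ≡ m * j
  j*[1+m]-j≡m*j = solve-∀

  k*[m-[1+n]]+n*j≡[k*m-j]+[1+n]*[j-k] : ∀ k m n j → k * (m - (+ 1 + n)) + n * j ≡ (k * m - j) + (+ 1 + n) * (j - k)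
  k*[m-[1+n]]+n*j≡[k*m-j]+[1+n]*[j-k] = solve-∀

  decompositions-+ : ∀ {a b} A s B t Q → a ≡ A + s * Q → b ≡ B + t * Q → a + b ≡ (A + B) + (s + t) * Q
  decompositions-+ A s B t Q a≡A+sQ b≡B+tQ =
    ≡.trans (≡.cong₂ _+_ a≡A+sQ b≡B+tQ) (regroup A s B t Q)
    where
      regroup : ∀ A s B t Q → (A + s * Q) + (B + t * Q) ≡ (A + B) + (s + t) * Q
      regroup = solve-∀

modZ-nonZero : ∀ n q .{{_ : NonZero q}} → n modZ q ≡ n ℤ.% + q
modZ-nonZero n (suc q) = ≡.refl

*-divN-common-divisor : ∀ j q g → g ∣ j → g ∣ q → Σ[ c ∈ ℕ ] j ℕ.* (q divN g) ≡ q ℕ.* c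
*-divN-common-divisor j q zero _ _ = 0 , ≡.trans (ℕ.*-zeroʳ j) (≡.sym (ℕ.*-zeroʳ q))
*-divN-common-divisor j q (suc g) (divides a ≡.refl) g∣q = a , (begin
  a ℕ.* suc g ℕ.* (q ℕ./ suc g) ≡⟨ ℕ.*-assoc a (suc g) _ ⟩
  a ℕ.* (suc g ℕ.* (q ℕ./ suc g)) ≡⟨ ≡.cong (a ℕ.*_) (ℕ.m*[n/m]≡n g∣q) ⟩
  a ℕ.* q ≡⟨ ℕ.*-comm a q ⟩
  q ℕ.* a ∎)
  where open ≡.≡-Reasoning

module _ {c ℓ} (R : CommutativeRing c ℓ) where
  open CommutativeRing R
  open Ramanujan R
  open import Relation.Binary.Reasoning.Setoid setoid
  open import Algebra.Properties.Semiring.Exp semiring using (_^_; ^-congˡ; ^-homo-*; ^-assocʳ)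
  open import Algebra.Properties.CommutativeSemigroup +-commutativeSemigroup using (interchange)
  open import Algebra.Properties.Group +-group using (x∙y⁻¹≈ε⇒x≈y; x≈y⇒x∙y⁻¹≈ε; ∙-cancelʳ)
  open import Algebra.Properties.Ring ring using (x[y-z]≈xy-xz; [y-z]x≈yx-zx)
  open import Algebra.Solver.Ring.NaturalCoefficients.Default commutativeSemiring using (solve; _:=_; _:+_; _:*_)

  pow≡^ : ∀ x n → pow x n ≡ x ^ n
  pow≡^ x zero = ≡.refl
  pow≡^ x (suc n) = ≡.cong (x *_) (pow≡^ x n)

  pow-cong : ∀ {x y} n → x ≈ y → pow x n ≈ pow y n
  pow-cong {x} {y} n x≈y rewrite pow≡^ x n | pow≡^ y n = ^-congˡ n x≈y

  pow-+ : ∀ x m n → pow x (m ℕ.+ n) ≈ pow x m * pow x n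
  pow-+ x m n rewrite pow≡^ x (m ℕ.+ n) | pow≡^ x m | pow≡^ x n = ^-homo-* x m n

  pow-* : ∀ x m n → pow x (m ℕ.* n) ≈ pow (pow x m) n
  pow-* x m n rewrite pow≡^ x (m ℕ.* n) | pow≡^ (pow x m) n | pow≡^ x m = sym (^-assocʳ x m n)

  pow-1# : ∀ n → pow 1# n ≈ 1#
  pow-1# zero = refl
  pow-1# (suc n) = trans (*-identityˡ _) (pow-1# n)

  pow-modN : ∀ {y} r → pow y r ≈ 1# → ∀ x → pow y (x modN r) ≈ pow y x
  pow-modN zero _ x = refl
  pow-modN {y} (suc r) yʳ≈1 x = sym (begin
    pow y x                                    ≡⟨ ≡.cong (pow y) (ℕ.m≡m%n+[m/n]*n x (suc r)) ⟩
    pow y (x ℕ.% suc r ℕ.+ t ℕ.* suc r)        ≡⟨ ≡.cong (λ e → pow y (x ℕ.% suc r ℕ.+ e)) (ℕ.*-comm t (suc r)) ⟩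
    pow y (x ℕ.% suc r ℕ.+ suc r ℕ.* t)        ≈⟨ pow-+ y (x ℕ.% suc r) (suc r ℕ.* t) ⟩
    pow y (x ℕ.% suc r) * pow y (suc r ℕ.* t)  ≈⟨ *-congˡ (trans (pow-* y (suc r) t) (pow-cong t yʳ≈1)) ⟩
    pow y (x ℕ.% suc r) * pow 1# t             ≈⟨ trans (*-congˡ (pow-1# t)) (*-identityʳ _) ⟩
    pow y (x ℕ.% suc r)                        ∎)
    where t = x ℕ./ suc r

  Σ₁-cong : ∀ N {f g : ℕ → Carrier} → (∀ i → 1 ≤ i → i ≤ N → f i ≈ g i) → Σ₁ N f ≈ Σ₁ N g
  Σ₁-cong zero f≈g = refl
  Σ₁-cong (suc N) f≈g =
    +-cong (Σ₁-cong N (λ i 1≤i i≤N → f≈g i 1≤i (ℕ.m≤n⇒m≤1+n i≤N))) (f≈g (suc N) (s≤s z≤n) ℕ.≤-refl)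

  Σ₁-0# : ∀ N → Σ₁ N (λ _ → 0#) ≈ 0#
  Σ₁-0# zero = refl
  Σ₁-0# (suc N) = trans (+-identityʳ _) (Σ₁-0# N)

  Σ₁-vanishing : ∀ N {f : ℕ → Carrier} → (∀ i → 1 ≤ i → i ≤ N → f i ≈ 0#) → Σ₁ N f ≈ 0#
  Σ₁-vanishing N f≈0 = trans (Σ₁-cong N f≈0) (Σ₁-0# N)

  if-else-0#≈0# : ∀ b {x} → x ≈ 0# → (if b then x else 0#) ≈ 0#
  if-else-0#≈0# true x≈0 = x≈0
  if-else-0#≈0# false _ = refl

  Σ₁-1# : ∀ N → Σ₁ N (λ _ → 1#) ≈ fromℕ N
  Σ₁-1# zero = refl
  Σ₁-1# (suc N) = trans (+-comm _ _) (+-congˡ (Σ₁-1# N))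

  Σ₁-distrib-+ : ∀ N (f g : ℕ → Carrier) → Σ₁ N (λ i → f i + g i) ≈ Σ₁ N f + Σ₁ N g
  Σ₁-distrib-+ zero f g = sym (+-identityˡ 0#)
  Σ₁-distrib-+ (suc N) f g = trans (+-congʳ (Σ₁-distrib-+ N f g)) (interchange _ _ _ _)

  *-distribˡ-Σ₁ : ∀ N x (f : ℕ → Carrier) → x * Σ₁ N f ≈ Σ₁ N (λ i → x * f i)
  *-distribˡ-Σ₁ zero x f = zeroʳ x
  *-distribˡ-Σ₁ (suc N) x f = trans (distribˡ x _ _) (+-congʳ (*-distribˡ-Σ₁ N x f))

  *-distribʳ-Σ₁ : ∀ N x (f : ℕ → Carrier) → Σ₁ N f * x ≈ Σ₁ N (λ i → f i * x)
  *-distribʳ-Σ₁ N x f = trans (*-comm _ x) (trans (*-distribˡ-Σ₁ N x f) (Σ₁-cong N (λ i _ _ → *-comm x (f i))))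

  Σ₁-comm : ∀ N M (f : ℕ → ℕ → Carrier) →
    Σ₁ N (λ i → Σ₁ M (λ j → f i j)) ≈ Σ₁ M (λ j → Σ₁ N (λ i → f i j))
  Σ₁-comm zero M f = sym (Σ₁-0# M)
  Σ₁-comm (suc N) M f =
    trans (+-congʳ (Σ₁-comm N M f)) (sym (Σ₁-distrib-+ M (λ j → Σ₁ N (λ i → f i j)) (f (suc N))))

  Σ₁-single : ∀ N j (f : ℕ → Carrier) → 1 ≤ j → j ≤ N →
    (∀ i → 1 ≤ i → i ≤ N → i ≢ j → f i ≈ 0#) → Σ₁ N f ≈ f j
  Σ₁-single zero (suc j) f 1≤j ()
  Σ₁-single (suc N) j f 1≤j j≤1+N f≈0 with ℕ.m≤n⇒m<n∨m≡n j≤1+N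
  ... | inj₁ (s≤s j≤N) =
    trans (+-cong (Σ₁-single N j f 1≤j j≤N below) (f≈0 (suc N) (s≤s z≤n) ℕ.≤-refl top≢j)) (+-identityʳ _)
    where
      below : ∀ i → 1 ≤ i → i ≤ N → i ≢ j → f i ≈ 0#
      below i 1≤i i≤N = f≈0 i 1≤i (ℕ.m≤n⇒m≤1+n i≤N)
      top≢j : suc N ≢ j
      top≢j 1+N≡j = ℕ.<-irrefl (≡.sym 1+N≡j) (s≤s j≤N)
  ... | inj₂ ≡.refl = trans (+-congʳ (Σ₁-vanishing N below)) (+-identityˡ _)
    where
      below : ∀ i → 1 ≤ i → i ≤ N → f i ≈ 0#
      below i 1≤i i≤N = f≈0 i 1≤i (ℕ.m≤n⇒m≤1+n i≤N) (λ i≡1+N → ℕ.<-irrefl i≡1+N (s≤s i≤N))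

  geometric-shift : ∀ y N → y * Σ₁ N (pow y) + y ≈ Σ₁ N (pow y) + pow y (suc N)
  geometric-shift y zero = +-cong (zeroʳ y) (sym (*-identityʳ y))
  geometric-shift y (suc N) = begin
    y * (S + yᴺ⁺¹) + y   ≈⟨ solve 3 (λ y S p → (y :* (S :+ p)) :+ y := ((y :* S) :+ y) :+ (y :* p)) refl y S yᴺ⁺¹ ⟩
    (y * S + y) + y * yᴺ⁺¹ ≈⟨ +-congʳ (geometric-shift y N) ⟩
    (S + yᴺ⁺¹) + y * yᴺ⁺¹ ∎
    where
      S = Σ₁ N (pow y)
      yᴺ⁺¹ = pow y (suc N)

  InjectiveOn : ℕ → (ℕ → Carrier) → Set ℓ
  InjectiveOn N x = ∀ i j → 1 ≤ i → i ≤ N → 1 ≤ j → j ≤ N → x i ≈ x j → i ≡ j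

  PowerSumsVanish : ℕ → (ℕ → Carrier) → (ℕ → Carrier) → Set ℓ
  PowerSumsVanish N x b = ∀ n → n < N → Σ₁ N (λ i → b i * pow (x i) n) ≈ 0#

  powerSumsVanish-deflate : ∀ M x b → PowerSumsVanish (suc M) x b →
    PowerSumsVanish M x (λ i → b i * (x i - x (suc M)))
  powerSumsVanish-deflate M x b vanish n n<M = begin
    Σ₁ M (λ i → b′ i * pow (x i) n)                                          ≈⟨ sym (+-identityʳ _) ⟩
    Σ₁ M (λ i → b′ i * pow (x i) n) + 0#                                     ≈⟨ +-congˡ (sym b′ₘ₊₁≈0) ⟩
    Σ₁ (suc M) (λ i → b′ i * pow (x i) n)                                    ≈⟨ Σ₁-cong (suc M) (λ i _ _ → expand (b i) (x i) (pow (x i) n)) ⟩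
    Σ₁ (suc M) (λ i → b i * pow (x i) (suc n) + - X * (b i * pow (x i) n))   ≈⟨ Σ₁-distrib-+ (suc M) _ _ ⟩
    S (suc n) + Σ₁ (suc M) (λ i → - X * (b i * pow (x i) n))                 ≈⟨ +-congˡ (sym (*-distribˡ-Σ₁ (suc M) (- X) _)) ⟩
    S (suc n) + - X * S n                                                    ≈⟨ +-cong (vanish (suc n) (s≤s n<M)) (*-congˡ (vanish n (ℕ.m≤n⇒m≤1+n n<M))) ⟩
    0# + - X * 0#                                                            ≈⟨ trans (+-identityˡ _) (zeroʳ _) ⟩
    0#                                                                       ∎
    where
      X = x (suc M)
      b′ : ℕ → Carrier
      b′ i = b i * (x i - X)
      S : ℕ → Carrier
      S n = Σ₁ (suc M) (λ i → b i * pow (x i) n)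
      b′ₘ₊₁≈0 : b′ (suc M) * pow X n ≈ 0#
      b′ₘ₊₁≈0 = trans (*-congʳ (trans (*-congˡ (-‿inverseʳ X)) (zeroʳ _))) (zeroˡ _)
      expand : ∀ β ξ p → β * (ξ - X) * p ≈ β * (ξ * p) + - X * (β * p)
      expand β ξ p = solve 4 (λ β ξ p m → (β :* (ξ :+ m)) :* p := (β :* (ξ :* p)) :+ (m :* (β :* p))) refl β ξ p (- X)

  module RootOfUnity (ζ : Carrier) (q : ℕ) .{{_ : NonZero q}} (ζ^q≈1 : pow ζ q ≈ 1#) where
    open WithRoot ζ q

    pow-multiple≈1 : ∀ s → pow ζ (q ℕ.* s) ≈ 1#
    pow-multiple≈1 s = trans (pow-* ζ q s) (trans (pow-cong s ζ^q≈1) (pow-1# s))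

    pow-+-multiple : ∀ y s → pow ζ (y ℕ.+ q ℕ.* s) ≈ pow ζ y
    pow-+-multiple y s = trans (pow-+ ζ y (q ℕ.* s)) (trans (*-congˡ (pow-multiple≈1 s)) (*-identityʳ _))

    pow-periodic : ∀ x y t → + x ≡ + y ℤ.+ t ℤ.* + q → pow ζ x ≈ pow ζ y
    pow-periodic x y t x≡y+tq with congruent⇒apart-by-multiple x y t q x≡y+tq
    ... | inj₁ (s , ≡.refl) = pow-+-multiple y s
    ... | inj₂ (s , ≡.refl) = sym (pow-+-multiple x s)

    zpow≡pow-% : ∀ a → zpow a ≡ pow ζ (a ℤ.% + q)
    zpow≡pow-% a = ≡.cong (pow ζ) (modZ-nonZero a q)

    zpow≈pow-mod : ∀ a x t → a ≡ + x ℤ.+ t ℤ.* + q → zpow a ≈ pow ζ x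
    zpow≈pow-mod a x t a≡x+tq = begin
      zpow a                ≡⟨ zpow≡pow-% a ⟩
      pow ζ r               ≈⟨ pow-periodic r x (t ℤ.- s) (residues-align a (+ r) (+ x) s t (+ q) (ℤ.a≡a%n+[a/n]*n a (+ q)) a≡x+tq) ⟩
      pow ζ x               ∎
      where
        r = a ℤ.% + q
        s = a ℤ./ + q

    zpow-pos : ∀ x → zpow (+ x) ≈ pow ζ x
    zpow-pos x = zpow≈pow-mod (+ x) x (+ 0) (≡.sym (ℤ.+-identityʳ (+ x)))

    zpow-homo-+ : ∀ a b → zpow (a ℤ.+ b) ≈ zpow a * zpow b
    zpow-homo-+ a b = begin
      zpow (a ℤ.+ b)        ≈⟨ zpow≈pow-mod (a ℤ.+ b) (r₁ ℕ.+ r₂) (s₁ ℤ.+ s₂) a+b≡r₁+r₂+[s₁+s₂]q ⟩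
      pow ζ (r₁ ℕ.+ r₂)     ≈⟨ pow-+ ζ r₁ r₂ ⟩
      pow ζ r₁ * pow ζ r₂   ≡⟨ ≡.sym (≡.cong₂ _*_ (zpow≡pow-% a) (zpow≡pow-% b)) ⟩
      zpow a * zpow b       ∎
      where
        r₁ = a ℤ.% + q
        r₂ = b ℤ.% + q
        s₁ = a ℤ./ + q
        s₂ = b ℤ./ + q
        a+b≡r₁+r₂+[s₁+s₂]q : a ℤ.+ b ≡ + (r₁ ℕ.+ r₂) ℤ.+ (s₁ ℤ.+ s₂) ℤ.* + q
        a+b≡r₁+r₂+[s₁+s₂]q = decompositions-+ (+ r₁) s₁ (+ r₂) s₂ (+ q) (ℤ.a≡a%n+[a/n]*n a (+ q)) (ℤ.a≡a%n+[a/n]*n b (+ q))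

    zpow-homo-* : ∀ n d → zpow (+ n ℤ.* d) ≈ pow (zpow d) n
    zpow-homo-* zero d = zpow-pos 0
    zpow-homo-* (suc n) d = begin
      zpow (+ suc n ℤ.* d)         ≡⟨ ≡.cong zpow (ℤ.suc-* (+ n) d) ⟩
      zpow (d ℤ.+ + n ℤ.* d)       ≈⟨ zpow-homo-+ d (+ n ℤ.* d) ⟩
      zpow d * zpow (+ n ℤ.* d)    ≈⟨ *-congˡ (zpow-homo-* n d) ⟩
      zpow d * pow (zpow d) n      ∎

    zpow-order : ∀ d → pow (zpow d) q ≈ 1#
    zpow-order d = trans (sym (zpow-homo-* q d))
      (zpow≈pow-mod (+ q ℤ.* d) 0 d (≡.trans (ℤ.*-comm (+ q) d) (≡.sym (ℤ.+-identityˡ (d ℤ.* + q)))))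

    ω-order : ∀ j → pow (ω j) (q′ j) ≈ 1#
    ω-order j with *-divN-common-divisor j q (gcd j q) (gcd[m,n]∣m j q) (gcd[m,n]∣n j q)
    ... | c , j*q′≡q*c = begin
      pow (pow ζ j) (q′ j)   ≈⟨ sym (pow-* ζ j (q′ j)) ⟩
      pow ζ (j ℕ.* q′ j)     ≡⟨ ≡.cong (pow ζ) j*q′≡q*c ⟩
      pow ζ (q ℕ.* c)        ≈⟨ pow-multiple≈1 c ⟩
      1#                     ∎

    v≈ω^[n-1] : ∀ j n → v j n ≈ pow (ω j) (n ∸ 1)
    v≈ω^[n-1] j n = pow-modN (q′ j) (ω-order j) (n ∸ 1)

    zpow[n*j]≈ω^n : ∀ n j → zpow (+ n ℤ.* + j) ≈ pow (ω j) n
    zpow[n*j]≈ω^n n j = trans (zpow-homo-* n (+ j)) (pow-cong n (zpow-pos j))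

    -- ζ^{k(m-n)} ω_j^{n-1} = ζ^{km-j} (ζ^{j-k})^n
    twisted-sum : ∀ j k m → Σ₁ q (λ n → zpow (+ k ℤ.* (+ m ℤ.- + n)) * v j n)
                          ≈ zpow (+ k ℤ.* + m ℤ.- + j) * Σ₁ q (pow (zpow (+ j ℤ.- + k)))
    twisted-sum j k m = trans (Σ₁-cong q term) (sym (*-distribˡ-Σ₁ q _ _))
      where
        J = + j
        K = + k
        M = + m
        term : ∀ n → 1 ≤ n → n ≤ q → zpow (K ℤ.* (M ℤ.- + n)) * v j n ≈ zpow (K ℤ.* M ℤ.- J) * pow (zpow (J ℤ.- K)) n
        term (suc n) _ _ = begin
          zpow (K ℤ.* (M ℤ.- + suc n)) * v j (suc n)              ≈⟨ *-congˡ (trans (v≈ω^[n-1] j (suc n)) (sym (zpow[n*j]≈ω^n n j))) ⟩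
          zpow (K ℤ.* (M ℤ.- + suc n)) * zpow (+ n ℤ.* J)         ≈⟨ sym (zpow-homo-+ _ _) ⟩
          zpow (K ℤ.* (M ℤ.- + suc n) ℤ.+ + n ℤ.* J)              ≡⟨ ≡.cong zpow (k*[m-[1+n]]+n*j≡[k*m-j]+[1+n]*[j-k] K M (+ n) J) ⟩
          zpow ((K ℤ.* M ℤ.- J) ℤ.+ + suc n ℤ.* (J ℤ.- K))        ≈⟨ zpow-homo-+ _ _ ⟩
          zpow (K ℤ.* M ℤ.- J) * zpow (+ suc n ℤ.* (J ℤ.- K))     ≈⟨ *-congˡ (zpow-homo-* (suc n) (J ℤ.- K)) ⟩
          zpow (K ℤ.* M ℤ.- J) * pow (zpow (J ℤ.- K)) (suc n)     ∎

    geometric-sum-diagonal : ∀ j → Σ₁ q (pow (zpow (+ j ℤ.- + j))) ≈ fromℕ q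
    geometric-sum-diagonal j = trans (Σ₁-cong q (λ n _ _ → trans (pow-cong n ζ⁰≈1) (pow-1# n))) (Σ₁-1# q)
      where
        ζ⁰≈1 : zpow (+ j ℤ.- + j) ≈ 1#
        ζ⁰≈1 = trans (reflexive (≡.cong zpow (ℤ.+-inverseʳ (+ j)))) (zpow-pos 0)

  module _ (domain : IsIntegralDomain) where

    *-almostCancelˡ : ∀ x {y z} → ¬ x ≈ 0# → x * y ≈ x * z → y ≈ z
    *-almostCancelˡ x {y} {z} x≉0 xy≈xz
      with proj₂ domain x (y - z) (trans (x[y-z]≈xy-xz x y z) (x≈y⇒x∙y⁻¹≈ε xy≈xz))
    ... | inj₁ x≈0 = contradiction x≈0 x≉0
    ... | inj₂ y-z≈0 = x∙y⁻¹≈ε⇒x≈y y z y-z≈0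

    geometric-sum-vanishes : ∀ y N → pow y N ≈ 1# → ¬ y ≈ 1# → Σ₁ N (pow y) ≈ 0#
    geometric-sum-vanishes y N yᴺ≈1 y≉1 = *-almostCancelˡ (y - 1#) y-1≉0 (begin
      (y - 1#) * S     ≈⟨ [y-z]x≈yx-zx S y 1# ⟩
      y * S - 1# * S   ≈⟨ +-congˡ (-‿cong (*-identityˡ S)) ⟩
      y * S - S        ≈⟨ x≈y⇒x∙y⁻¹≈ε (∙-cancelʳ y (y * S) S yS+y≈S+y) ⟩
      0#               ≈⟨ sym (zeroʳ _) ⟩
      (y - 1#) * 0#    ∎)
      where
        S = Σ₁ N (pow y)
        y-1≉0 : ¬ y - 1# ≈ 0#
        y-1≉0 y-1≈0 = y≉1 (x∙y⁻¹≈ε⇒x≈y y 1# y-1≈0)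
        yS+y≈S+y : y * S + y ≈ S + y
        yS+y≈S+y = trans (geometric-shift y N) (+-congˡ (trans (*-congˡ yᴺ≈1) (*-identityʳ y)))

    vandermonde : ∀ N x b → InjectiveOn N x → PowerSumsVanish N x b → ∀ j → 1 ≤ j → j ≤ N → b j ≈ 0#
    vandermonde zero x b _ _ (suc j) _ ()
    vandermonde (suc M) x b inj vanish = bⱼ≈0
      where
        X = x (suc M)

        injM : InjectiveOn M x
        injM i j 1≤i i≤M 1≤j j≤M = inj i j 1≤i (ℕ.m≤n⇒m≤1+n i≤M) 1≤j (ℕ.m≤n⇒m≤1+n j≤M)

        lower : ∀ i → 1 ≤ i → i ≤ M → b i ≈ 0#
        lower i 1≤i i≤M
          with proj₂ domain (b i) (x i - X) (vandermonde M x _ injM (powerSumsVanish-deflate M x b vanish) i 1≤i i≤M)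
        ... | inj₁ bᵢ≈0 = bᵢ≈0
        ... | inj₂ xᵢ-X≈0 = contradiction i≡1+M (ℕ.<⇒≢ (s≤s i≤M))
          where
            i≡1+M : i ≡ suc M
            i≡1+M = inj i (suc M) 1≤i (ℕ.m≤n⇒m≤1+n i≤M) (s≤s z≤n) ℕ.≤-refl (x∙y⁻¹≈ε⇒x≈y (x i) X xᵢ-X≈0)

        lower-summand≈0 : ∀ i → 1 ≤ i → i ≤ M → b i * pow (x i) 0 ≈ 0#
        lower-summand≈0 i 1≤i i≤M = trans (*-identityʳ (b i)) (lower i 1≤i i≤M)

        top : b (suc M) ≈ 0#
        top = begin
          b (suc M)                                   ≈⟨ sym (+-identityˡ _) ⟩
          0# + b (suc M)                              ≈⟨ +-cong (sym (Σ₁-vanishing M lower-summand≈0)) (sym (*-identityʳ _)) ⟩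
          Σ₁ (suc M) (λ i → b i * pow (x i) 0)      ≈⟨ vanish 0 (s≤s z≤n) ⟩
          0#                                          ∎

        bⱼ≈0 : ∀ j → 1 ≤ j → j ≤ suc M → b j ≈ 0#
        bⱼ≈0 j 1≤j j≤1+M with ℕ.m≤n⇒m<n∨m≡n j≤1+M
        ... | inj₁ (s≤s j≤M) = lower j 1≤j j≤M
        ... | inj₂ ≡.refl = top

    module _ (ζ : Carrier) (q : ℕ) .{{_ : NonZero q}} (ζ-primitive : IsPrimitiveRoot ζ q) where
      open WithRoot ζ q
      open RootOfUnity ζ q (proj₁ ζ-primitive)

      pow≉0# : ∀ i → i ≤ q → ¬ pow ζ i ≈ 0#
      pow≉0# i i≤q ζⁱ≈0 = proj₁ domain (begin
        1#                           ≈⟨ sym (proj₁ ζ-primitive) ⟩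
        pow ζ q                      ≡⟨ ≡.cong (pow ζ) (≡.sym (ℕ.m+[n∸m]≡n i≤q)) ⟩
        pow ζ (i ℕ.+ (q ∸ i))        ≈⟨ pow-+ ζ i (q ∸ i) ⟩
        pow ζ i * pow ζ (q ∸ i)      ≈⟨ trans (*-congʳ ζⁱ≈0) (zeroˡ _) ⟩
        0#                           ∎)

      pow-injective-< : ∀ i j → 1 ≤ i → i < j → j ≤ q → ¬ pow ζ i ≈ pow ζ j
      pow-injective-< i j 1≤i i<j j≤q ζⁱ≈ζʲ = proj₂ ζ-primitive d 1≤d d<q (sym 1≈ζᵈ)
        where
          d = j ∸ i
          i+d≡j : i ℕ.+ d ≡ j
          i+d≡j = ℕ.m+[n∸m]≡n (ℕ.<⇒≤ i<j)
          1≤d : 1 ≤ d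
          1≤d = ℕ.m<n⇒0<n∸m i<j
          d<q : d < q
          d<q = ℕ.<-≤-trans (ℕ.∸-monoʳ-< {o = 0} 1≤i (ℕ.<⇒≤ i<j)) j≤q
          1≈ζᵈ : 1# ≈ pow ζ d
          1≈ζᵈ = *-almostCancelˡ (pow ζ i) (pow≉0# i (ℕ.<⇒≤ (ℕ.<-≤-trans i<j j≤q))) (begin
            pow ζ i * 1#             ≈⟨ *-identityʳ _ ⟩
            pow ζ i                  ≈⟨ ζⁱ≈ζʲ ⟩
            pow ζ j                  ≡⟨ ≡.cong (pow ζ) (≡.sym i+d≡j) ⟩
            pow ζ (i ℕ.+ d)          ≈⟨ pow-+ ζ i d ⟩
            pow ζ i * pow ζ d        ∎)

      pow-injective : InjectiveOn q (pow ζ)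
      pow-injective i j 1≤i i≤q 1≤j j≤q ζⁱ≈ζʲ with ℕ.<-cmp i j
      ... | tri< i<j _ _ = contradiction ζⁱ≈ζʲ (pow-injective-< i j 1≤i i<j j≤q)
      ... | tri≈ _ i≡j _ = i≡j
      ... | tri> _ _ j<i = contradiction (sym ζⁱ≈ζʲ) (pow-injective-< j i 1≤j j<i i≤q)

      v-independent : (a : ℕ → Carrier) → ((n : ℕ) → 1 ≤ n → n ≤ q → Σ₁ q (λ j → a j * v j n) ≈ 0#)
        → (j : ℕ) → 1 ≤ j → j ≤ q → a j ≈ 0#
      v-independent a vanish = vandermonde q ω a pow-injective (λ n n<q →
        trans (Σ₁-cong q (λ j _ _ → *-congˡ (sym (v≈ω^[n-1] j (suc n))))) (vanish (suc n) (s≤s z≤n) n<q))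

      geometric-sum-off-diagonal : ∀ j k → 1 ≤ j → j ≤ q → 1 ≤ k → k ≤ q → k ≢ j →
        Σ₁ q (pow (zpow (+ j ℤ.- + k))) ≈ 0#
      geometric-sum-off-diagonal j k 1≤j j≤q 1≤k k≤q k≢j =
        geometric-sum-vanishes _ q (zpow-order (+ j ℤ.- + k)) (λ ζʲ⁻ᵏ≈1 → k≢j (pow-injective k j 1≤k k≤q 1≤j j≤q (begin
          pow ζ k                                   ≈⟨ sym (*-identityˡ _) ⟩
          1# * pow ζ k                              ≈⟨ *-cong (sym ζʲ⁻ᵏ≈1) (sym (zpow-pos k)) ⟩
          zpow (+ j ℤ.- + k) * zpow (+ k)           ≈⟨ sym (zpow-homo-+ (+ j ℤ.- + k) (+ k)) ⟩
          zpow ((+ j ℤ.- + k) ℤ.+ + k)              ≡⟨ ≡.cong zpow ([j-k]+k≡j (+ j) (+ k)) ⟩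
          zpow (+ j)                                ≈⟨ zpow-pos j ⟩
          pow ζ j                                   ∎)))

      Av≈λ′v : ∀ j → 1 ≤ j → j ≤ q → ∀ m → 1 ≤ m → m ≤ q → Av j m ≈ λ′ j * v j m
      Av≈λ′v j 1≤j j≤q (suc m) _ _ = begin
        Av j (suc m)                                         ≈⟨ Σ₁-cong q (λ n _ _ → *-distribʳ-Σ₁ q (v j n) _) ⟩
        Σ₁ q (λ n → Σ₁ q (λ k → term k n * v j n))           ≈⟨ Σ₁-comm q q _ ⟩
        Σ₁ q (λ k → Σ₁ q (λ n → term k n * v j n))           ≈⟨ Σ₁-cong q (λ k _ _ → column k) ⟩
        Σ₁ q (λ k → if coprime? k q then X k * G k else 0#)  ≈⟨ Σ₁-single q j _ 1≤j j≤q off-diagonal ⟩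
        (if coprime? j q then X j * G j else 0#)             ≈⟨ diagonal ⟩
        λ′ j * v j (suc m)                                   ∎
        where
          term : ℕ → ℕ → Carrier
          term k n = if coprime? k q then zpow (+ k ℤ.* (+ suc m ℤ.- + n)) else 0#
          X : ℕ → Carrier
          X k = zpow (+ k ℤ.* + suc m ℤ.- + j)
          G : ℕ → Carrier
          G k = Σ₁ q (pow (zpow (+ j ℤ.- + k)))

          column : ∀ k → Σ₁ q (λ n → term k n * v j n) ≈ (if coprime? k q then X k * G k else 0#)
          column k with coprime? k q
          ... | true = twisted-sum j k (suc m)
          ... | false = Σ₁-vanishing q (λ n _ _ → zeroˡ (v j n))

          off-diagonal : ∀ k → 1 ≤ k → k ≤ q → k ≢ j → (if coprime? k q then X k * G k else 0#) ≈ 0#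
          off-diagonal k 1≤k k≤q k≢j =
            if-else-0#≈0# (coprime? k q) (trans (*-congˡ (geometric-sum-off-diagonal j k 1≤j j≤q 1≤k k≤q k≢j)) (zeroʳ _))

          Xj≈v : X j ≈ v j (suc m)
          Xj≈v = trans (reflexive (≡.cong zpow (j*[1+m]-j≡m*j (+ j) (+ m))))
                       (trans (zpow[n*j]≈ω^n m j) (sym (v≈ω^[n-1] j (suc m))))

          diagonal : (if coprime? j q then X j * G j else 0#) ≈ λ′ j * v j (suc m)
          diagonal with coprime? j q
          ... | true = trans (*-cong Xj≈v (geometric-sum-diagonal j)) (*-comm _ _)
          ... | false = sym (zeroˡ _)

corollary1 : {c ℓ : Level} (R : CommutativeRing c ℓ) → let open CommutativeRing R in let open Ramanujan R in
    IsIntegralDomain → (ζ : Carrier) → (q : ℕ) → .{{_ : NonZero q}} → IsPrimitiveRoot ζ q →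
    let open WithRoot ζ q in
    ((j : ℕ) → 1 ≤ j → j ≤ q → (m : ℕ) → 1 ≤ m → m ≤ q → Av j m ≈ λ′ j * v j m)
    × ((a : ℕ → Carrier) → ((n : ℕ) → 1 ≤ n → n ≤ q → Σ₁ q (λ j → a j * v j n) ≈ 0#)
        → (j : ℕ) → 1 ≤ j → j ≤ q → a j ≈ 0#)
corollary1 R domain ζ q ζ-primitive = Av≈λ′v R domain ζ q ζ-primitive , v-independent R domain ζ q ζ-primitive
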